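{- For every $n\ge1$ and every $f\in B_n$, the circuit complexity of $f$ (the minimum number of non-input gates in a circuit with fan-in two $\land$, $\lor$ gates and $\neg$ gates computing $f$) is at most $|\mathcal{P}(f)|$, the size of a minimal $pPol$ cover for $f$.
   Context: $B_k$ is the set of Boolean functions $\{0,1\}^k\to\{0,1\}$ and $P_k$ the set of partial functions from $\{0,1\}^k$ to $\{0,1\}$ (possibly undefined on some inputs). Enumerate $\{0,1\}^n$ lexicographically as $a^1,\dots,a^{2^n}$. The truth table $f^{\bullet}$ is the $2^n\times(n+1)$ matrix with rows $(a^j,f(a^j))$. Vectors in $\{0,1\}^{2^n}$ are called columns; the columns of $f^{\bullet}$ are the input columns $x_1,\dots,x_n$ ($x_i[j]=a^j_i$) and the result column $r$ ($r[j]=f(a^j)$). For $w\in P_{2^n}$ and a column $v$, $w(v)$ denotes $w(v[1],\dots,v[2^n])$, which may be undefined. $\overline{pPol}(f^{\bullet})$ is the set of $w\in P_{2^n}$ such that $w(x_1),\dots,w(x_n),w(r)$ are all defined and $(w(x_1),\dots,w(x_n),w(r))$ is not a row of $f^{\bullet}$ (i.e. $w(r)\ne f(w(x_1),\dots,w(x_n))$). Gates: an $\land$-gate is a triple $(u,v,z)$ of columns with $z=u\land v$ componentwise, an $\lor$-gate a triple with $z=u\lor v$, a $\neg$-gate a pair $(u,z)$ with $z=\neg u$; $u,v$ are its input columns and $z$ its output column, and $\circ$ its operation. A gate covers $w\in P_{2^n}$ if $w$ is defined on all its input columns and either $w$ is undefined on its output column or $w(z)\neq w(u)\circ w(v)$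 (resp. $w(z)\neq\neg w(u)$). A $pPol$ cover for $f$ is a collection $\mathcal{P}$ of such gates such that every $w\in\overline{pPol}(f^{\bullet})$ is covered by some gate in $\mathcal{P}$, and moreover: (1) no two gates of $\mathcal{P}$ have the same output column, (2) $r$ is not an input column of any gate in $\mathcal{P}$, and (3) none of $x_1,\dots,x_n$ is the output column of a gate in $\mathcal{P}$. $\mathcal{P}(f)$ denotes a $pPol$ cover for $f$ with the minimum number of gates, and $|\mathcal{P}(f)|$ its number of gates. -}

module Defs where

open import Data.Bool using (Bool; true; false; _∧_; _∨_; not)
open import Data.Nat using (ℕ; zero; suc; _+_; _∸_; _^_; _≤_; _/_; _%_)
open import Data.Nat.Properties using (m^n≢0)
open import Data.Fin using (Fin; toℕ)
open import Data.Vec using (Vec; []; _∷_; tabulate; lookup)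
open import Data.Maybe using (Maybe; just; nothing)
open import Data.Product using (Σ; ∃; _×_; _,_)
open import Data.Sum using (_⊎_)
open import Relation.Nullary using (¬_)
open import Relation.Binary.PropositionalEquality using (_≡_; _≢_; _≗_)

BoolFn : ℕ → Set
BoolFn k = (Fin k → Bool) → Bool

PartialFn : ℕ → Set
PartialFn k = (Fin k → Bool) → Maybe Bool

-- Rows are indexed by j ∈ Fin (2^n) (0-based; the paper's a^{j+1}).
-- Lexicographic enumeration: a^{j+1} is the binary expansion of j with
-- x_1 (index 0) the most significant bit.
bitOf : ℕ → ℕ → Bool
bitOf j e with (j / 2 ^ e) {{m^n≢0 2 e}} % 2
... | zero = false
... | suc _ = true

row : (n : ℕ) → Fin (2 ^ n) → Fin n → Bool
row n j i = bitOf (toℕ j) (n ∸ suc (toℕ i))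

Col : ℕ → Set
Col n = Fin (2 ^ n) → Bool

xcol : (n : ℕ) → Fin n → Col n
xcol n i j = row n j i

rcol : (n : ℕ) → BoolFn n → Col n
rcol n f j = f (row n j)

InPPolBar : (n : ℕ) → BoolFn n → PartialFn (2 ^ n) → Set
InPPolBar n f w =
  Σ (Fin n → Bool) λ bs → Σ Bool λ b →
    (∀ i → w (xcol n i) ≡ just (bs i)) × (w (rcol n f) ≡ just b) × (b ≢ f bs)

data Gate (n : ℕ) : Set where
  andG : Col n → Col n → Col n → Gate n
  orG  : Col n → Col n → Col n → Gate n
  notG : Col n → Col n → Gate n

IsValidGate : {n : ℕ} → Gate n → Set
IsValidGate (andG u v z) = ∀ j → z j ≡ (u j ∧ v j)
IsValidGate (orG u v z)  = ∀ j → z j ≡ (u j ∨ v j)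
IsValidGate (notG u z)   = ∀ j → z j ≡ not (u j)

outCol : {n : ℕ} → Gate n → Col n
outCol (andG u v z) = z
outCol (orG u v z)  = z
outCol (notG u z)   = z

IsInputCol : {n : ℕ} → Col n → Gate n → Set
IsInputCol c (andG u v z) = (u ≗ c) ⊎ (v ≗ c)
IsInputCol c (orG u v z)  = (u ≗ c) ⊎ (v ≗ c)
IsInputCol c (notG u z)   = u ≗ c

Violates : Maybe Bool → Bool → Set
Violates m e = (m ≡ nothing) ⊎ Σ Bool λ c → (m ≡ just c) × (c ≢ e)

Covers : {n : ℕ} → Gate n → PartialFn (2 ^ n) → Set
Covers (andG u v z) w = Σ Bool λ a → Σ Bool λ b →
  (w u ≡ just a) × (w v ≡ just b) × Violates (w z) (a ∧ b)
Covers (orG u v z) w = Σ Bool λ a → Σ Bool λ b →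
  (w u ≡ just a) × (w v ≡ just b) × Violates (w z) (a ∨ b)
Covers (notG u z) w = Σ Bool λ a →
  (w u ≡ just a) × Violates (w z) (not a)

record IsPPolCover (n : ℕ) (f : BoolFn n) (m : ℕ) (P : Fin m → Gate n) : Set where
  field
    valid   : ∀ i → IsValidGate (P i)
    covers  : ∀ w → InPPolBar n f w → Σ (Fin m) λ i → Covers (P i) w
    distOut : ∀ i k → outCol (P i) ≗ outCol (P k) → i ≡ k
    rNotIn  : ∀ i → ¬ IsInputCol (rcol n f) (P i)
    xNotOut : ∀ i k → ¬ (outCol (P i) ≗ xcol n k)

data Op (m : ℕ) : Set where
  andOp : Fin m → Fin m → Op m
  orOp  : Fin m → Fin m → Op m
  notOp : Fin m → Op m

data Circuit (n : ℕ) : ℕ → Set where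
  []  : Circuit n zero
  _▷_ : {s : ℕ} → Circuit n s → Op (s + n) → Circuit n (suc s)

evalOp : {m : ℕ} → Op m → Vec Bool m → Bool
evalOp (andOp a b) vs = lookup vs a ∧ lookup vs b
evalOp (orOp a b)  vs = lookup vs a ∨ lookup vs b
evalOp (notOp a)   vs = not (lookup vs a)

-- values of all nodes (most recent gate first, inputs last)
values : {n s : ℕ} → Circuit n s → (Fin n → Bool) → Vec Bool (s + n)
values [] x = tabulate x
values (c ▷ op) x = let vs = values c x in evalOp op vs ∷ vs

Computes : {n s : ℕ} → Circuit n s → Fin (s + n) → BoolFn n → Set
Computes c o f = ∀ x → lookup (values c x) o ≡ f x

CCAtMost : (n : ℕ) → BoolFn n → ℕ → Set
CCAtMost n f k = Σ ℕ λ s → (s ≤ k) × Σ (Circuit n s) λ c → Σ (Fin (s + n)) λ o → Computes c o f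

-- Greedily add gates of the cover whose input columns are already computed and whose
-- output column is not; no gate is added twice, so this stops after at most m steps
-- with a circuit whose set A of computed columns contains every x_i and is closed under
-- the gates of the cover. Evaluating the columns of A at the row of an assignment x,
-- sending r to ¬ f x when r ∉ A, and leaving every other column undefined gives a
-- partial function w. If r ∉ A, or if r ∈ A but r disagrees with f at x, then w lies in
-- pPol-bar(f•), yet no gate covers it: the inputs of a covering gate are defined and not
-- r, hence in A, so its output is in A and w is correct on it.
module Submission where

open import Defs
open import Data.Bool using (Bool; true; false; not; _∧_; _∨_; _≟_)
open import Data.Bool.Properties using (not-¬)
open import Data.Nat using (ℕ; zero; suc; _+_; _*_; _∸_; _^_; _≤_; _<_; _/_; _%_; s≤s; z≤n)
open import Data.Nat.Properties
  using (m^n≢0; m^n>0; n∸n≡0; +-∸-assoc; +-suc; m≤m+n; <⇒≱; +-monoˡ-≤; *-monoˡ-≤; *-comm;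
         module ≤-Reasoning)
open import Data.Nat.DivMod
  using (m/n/o≡m/[n*o]; +-distrib-/-∣ʳ; m<n⇒m/n≡0; m*n/n≡m; n/1≡n; [m+kn]%n≡m%n)
open import Data.Nat.Divisibility using (n∣m*n)
open import Data.Fin using (Fin; toℕ; fromℕ; fromℕ<; inject₁; _↑ʳ_)
import Data.Fin as Fin
open import Data.Fin.Properties
  using (toℕ-fromℕ; toℕ-inject₁; toℕ<n; toℕ-fromℕ<; all?; any?; injective⇒≤)
open import Data.Fin.Relation.Unary.Top using (view; ‵fromℕ; ‵inject₁)
open import Data.Vec using (lookup; _∷_)
open import Data.Vec.Properties using (tabulate-cong; lookup∘tabulate)
open import Data.Maybe using (just; nothing)
open import Data.Maybe.Properties using (just-injective)
open import Data.Product using (Σ; ∃; _×_; _,_; proj₁; proj₂)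
open import Data.Sum using (inj₁; inj₂)
open import Data.Empty using (⊥-elim)
open import Function using (_∘_)
open import Function.Definitions using (Injective)
open import Relation.Nullary using (¬_; Dec; yes; no; ¬?)
open import Relation.Nullary.Decidable using (_×-dec_; decidable-stable)
open import Relation.Unary using (Decidable)
open import Relation.Binary.PropositionalEquality

bit : Bool → ℕ
bit false = 0
bit true  = 1

bit<2 : ∀ b → bit b < 2
bit<2 false = s≤s z≤n
bit<2 true  = s≤s (s≤s z≤n)

isPositive : ℕ → Bool
isPositive zero    = false
isPositive (suc _) = true

bitOf-unfold : ∀ j e → bitOf j e ≡ isPositive ((j / 2 ^ e) {{m^n≢0 2 e}} % 2)
bitOf-unfold j e with (j / 2 ^ e) {{m^n≢0 2 e}} % 2
... | zero  = refl
... | suc _ = refl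

bitOf-suc : ∀ j e → bitOf j (suc e) ≡ bitOf (j / 2) e
bitOf-suc j e rewrite bitOf-unfold j (suc e) | bitOf-unfold (j / 2) e =
  cong (λ t → isPositive (t % 2))
    (sym (m/n/o≡m/[n*o] j 2 (2 ^ e) {{_}} {{m^n≢0 2 e}} {{m^n≢0 2 (suc e)}}))

bitOf-zero : ∀ b N → bitOf (bit b + N * 2) 0 ≡ b
bitOf-zero b N = begin
  bitOf (bit b + N * 2) 0              ≡⟨ bitOf-unfold (bit b + N * 2) 0 ⟩
  isPositive ((bit b + N * 2) / 1 % 2) ≡⟨ cong (λ t → isPositive (t % 2)) (n/1≡n (bit b + N * 2)) ⟩
  isPositive ((bit b + N * 2) % 2)     ≡⟨ cong isPositive ([m+kn]%n≡m%n (bit b) N 2) ⟩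
  isPositive (bit b % 2)               ≡⟨ isPositive-bit b ⟩
  b                                    ∎
  where
  open ≡-Reasoning
  isPositive-bit : ∀ b → isPositive (bit b % 2) ≡ b
  isPositive-bit false = refl
  isPositive-bit true  = refl

[bit+N*2]/2≡N : ∀ b N → (bit b + N * 2) / 2 ≡ N
[bit+N*2]/2≡N b N =
  trans (+-distrib-/-∣ʳ (bit b) (n∣m*n N)) (cong₂ _+_ (m<n⇒m/n≡0 (bit<2 b)) (m*n/n≡m N 2))

-- Inverse of row: the last variable is the least significant bit.
encode : (n : ℕ) → (Fin n → Bool) → ℕ
encode zero    x = 0
encode (suc n) x = bit (x (fromℕ n)) + encode n (x ∘ inject₁) * 2

encode< : ∀ n x → encode n x < 2 ^ n
encode< zero    x = s≤s z≤n
encode< (suc n) x = begin-strict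
  bit b + N * 2 <⟨ +-monoˡ-≤ (N * 2) (bit<2 b) ⟩
  suc N * 2     ≤⟨ *-monoˡ-≤ 2 (encode< n (x ∘ inject₁)) ⟩
  2 ^ n * 2     ≡⟨ *-comm (2 ^ n) 2 ⟩
  2 ^ suc n     ∎
  where
  open ≤-Reasoning
  b : Bool
  b = x (fromℕ n)
  N : ℕ
  N = encode n (x ∘ inject₁)

encode-bits : ∀ n x i → bitOf (encode n x) (n ∸ suc (toℕ i)) ≡ x i
encode-bits (suc n) x i with view i
... | ‵fromℕ rewrite toℕ-fromℕ n | n∸n≡0 n =
  bitOf-zero (x (fromℕ n)) (encode n (x ∘ inject₁))
... | ‵inject₁ i rewrite toℕ-inject₁ i | +-∸-assoc 1 (toℕ<n i) = begin
  bitOf (bit b + N * 2) (suc e)   ≡⟨ bitOf-suc (bit b + N * 2) e ⟩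
  bitOf ((bit b + N * 2) / 2) e   ≡⟨ cong (λ t → bitOf t e) ([bit+N*2]/2≡N b N) ⟩
  bitOf N e                       ≡⟨ encode-bits n (x ∘ inject₁) i ⟩
  x (inject₁ i)                   ∎
  where
  open ≡-Reasoning
  b : Bool
  b = x (fromℕ n)
  N : ℕ
  N = encode n (x ∘ inject₁)
  e : ℕ
  e = n ∸ suc (toℕ i)

row-surjective : ∀ n (x : Fin n → Bool) → ∃ λ j → row n j ≗ x
row-surjective n x = fromℕ< (encode< n x) , λ i →
  subst (λ t → bitOf t (n ∸ suc (toℕ i)) ≡ x i) (sym (toℕ-fromℕ< (encode< n x))) (encode-bits n x i)

_≗?_ : ∀ {k} (u v : Fin k → Bool) → Dec (u ≗ v)
u ≗? v = all? (λ j → u j ≟ v j)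

¬Violates-just : ∀ {m e} → m ≡ just e → ¬ Violates m e
¬Violates-just refl (inj₁ ())
¬Violates-just refl (inj₂ (_ , refl , c≢c)) = c≢c refl

module _ {n : ℕ} where

  InputsIn : (Col n → Set) → Gate n → Set
  InputsIn A (andG u v _) = A u × A v
  InputsIn A (orG u v _)  = A u × A v
  InputsIn A (notG u _)   = A u

  inputsIn? : {A : Col n → Set} → Decidable A → (g : Gate n) → Dec (InputsIn A g)
  inputsIn? A? (andG u v _) = A? u ×-dec A? v
  inputsIn? A? (orG u v _)  = A? u ×-dec A? v
  inputsIn? A? (notG u _)   = A? u

  ClosedUnder : {m : ℕ} → (Fin m → Gate n) → (Col n → Set) → Set
  ClosedUnder P A = ∀ i → InputsIn A (P i) → A (outCol (P i))

module Probe {n : ℕ} (f : BoolFn n) {A : Col n → Set} (A? : Decidable A)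
             (x : Fin n → Bool) (j : Fin (2 ^ n)) where

  r : Col n
  r = rcol n f

  probe : PartialFn (2 ^ n)
  probe v with A? v
  ... | yes _ = just (v j)
  ... | no _ with v ≗? r
  ...   | yes _ = just (not (f x))
  ...   | no _  = nothing

  probe-∈ : ∀ {v} → A v → probe v ≡ just (v j)
  probe-∈ {v} v∈A with A? v
  ... | yes _   = refl
  ... | no v∉A = ⊥-elim (v∉A v∈A)

  probe-rcol : ¬ A r → probe r ≡ just (not (f x))
  probe-rcol r∉A with A? r
  ... | yes r∈A = ⊥-elim (r∉A r∈A)
  ... | no _ with r ≗? r
  ...   | yes _ = refl
  ...   | no r≉r = ⊥-elim (r≉r (λ _ → refl))

  probe-defined : ∀ {v a} → probe v ≡ just a → ¬ (v ≗ r) → A v × v j ≡ a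
  probe-defined {v} eq v≉r with A? v
  ... | yes v∈A = v∈A , just-injective eq
  ... | no _ with v ≗? r
  ...   | yes v≈r = ⊥-elim (v≉r v≈r)
  probe-defined () _ | no _ | no _

  probe-uncovered : (g : Gate n) → IsValidGate g → ¬ IsInputCol r g →
                    (InputsIn A g → A (outCol g)) → ¬ Covers g probe
  probe-uncovered (andG u v z) valid r∉in closed (a , b , pu , pv , violation)
    with probe-defined pu (r∉in ∘ inj₁) | probe-defined pv (r∉in ∘ inj₂)
  ... | u∈A , refl | v∈A , refl =
    ¬Violates-just (trans (probe-∈ {z} (closed (u∈A , v∈A))) (cong just (valid j))) violation
  probe-uncovered (orG u v z) valid r∉in closed (a , b , pu , pv , violation)
    with probe-defined pu (r∉in ∘ inj₁) | probe-defined pv (r∉in ∘ inj₂)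
  ... | u∈A , refl | v∈A , refl =
    ¬Violates-just (trans (probe-∈ {z} (closed (u∈A , v∈A))) (cong just (valid j))) violation
  probe-uncovered (notG u z) valid r∉in closed (a , pu , violation)
    with probe-defined pu r∉in
  ... | u∈A , refl =
    ¬Violates-just (trans (probe-∈ {z} (closed u∈A)) (cong just (valid j))) violation

  probe-∈-pPolBar : (∀ i → A (xcol n i)) → row n j ≗ x →
                    ∀ {b} → probe r ≡ just b → b ≢ f x → InPPolBar n f probe
  probe-∈-pPolBar inputs row≗x {b} pr b≢fx =
    x , b , (λ i → trans (probe-∈ (inputs i)) (cong just (row≗x i))) , pr , b≢fx

module _ {n m : ℕ} {f : BoolFn n} {P : Fin m → Gate n} (cover : IsPPolCover n f m P)
         {A : Col n → Set} (A? : Decidable A)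
         (inputs : ∀ i → A (xcol n i)) (closed : ClosedUnder P A) where

  open IsPPolCover cover

  probe-rcol-correct : ∀ x j → row n j ≗ x →
                       ∀ {b} → Probe.probe f A? x j (rcol n f) ≡ just b → b ≡ f x
  probe-rcol-correct x j row≗x {b} pr = decidable-stable (b ≟ f x) λ b≢fx →
    let (i , covered) = covers _ (probe-∈-pPolBar inputs row≗x pr b≢fx)
    in probe-uncovered (P i) (valid i) (rNotIn i) (closed i) covered
    where open Probe f A? x j

  rcol-∈-closure : A (rcol n f)
  rcol-∈-closure with A? (rcol n f)
  ... | yes r∈A = r∈A
  ... | no r∉A  = ⊥-elim (not-¬ (probe-rcol-correct x₀ j₀ (λ _ → refl) (probe-rcol r∉A)) refl)
    where
    j₀ : Fin (2 ^ n)
    j₀ = fromℕ< (m^n>0 2 n)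
    x₀ : Fin n → Bool
    x₀ = row n j₀
    open Probe f A? x₀ j₀

  rcol-correct : ∀ x j → row n j ≗ x → rcol n f j ≡ f x
  rcol-correct x j row≗x = probe-rcol-correct x j row≗x (probe-∈ rcol-∈-closure)
    where open Probe f A? x j

module _ {n : ℕ} where

  values-cong : ∀ {s} (c : Circuit n s) {x y : Fin n → Bool} → x ≗ y → values c x ≡ values c y
  values-cong []       x≗y = tabulate-cong x≗y
  values-cong (c ▷ op) x≗y = cong (λ vs → evalOp op vs ∷ vs) (values-cong c x≗y)

  lookup-values-↑ʳ : ∀ {s} (c : Circuit n s) x i → lookup (values c x) (s ↑ʳ i) ≡ x i
  lookup-values-↑ʳ []       x i = lookup∘tabulate x i
  lookup-values-↑ʳ (c ▷ op) x i = lookup-values-↑ʳ c x i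

  colOf : ∀ {s} → Circuit n s → Fin (s + n) → Col n
  colOf c k j = lookup (values c (row n j)) k

  Computed : ∀ {s} → Circuit n s → Col n → Set
  Computed c v = ∃ λ k → colOf c k ≗ v

  computed? : ∀ {s} (c : Circuit n s) → Decidable (Computed c)
  computed? c v = any? (λ k → colOf c k ≗? v)

  xcol-computed : ∀ {s} (c : Circuit n s) i → Computed c (xcol n i)
  xcol-computed {s} c i = s ↑ʳ i , λ j → lookup-values-↑ʳ c (row n j) i

  gateOp : ∀ {s} (c : Circuit n s) (g : Gate n) → IsValidGate g → InputsIn (Computed c) g →
           Σ (Op (s + n)) λ op → colOf (c ▷ op) Fin.zero ≗ outCol g
  gateOp c (andG u v z) valid ((k , k≗u) , (l , l≗v)) =
    andOp k l , λ j → trans (cong₂ _∧_ (k≗u j) (l≗v j)) (sym (valid j))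
  gateOp c (orG u v z)  valid ((k , k≗u) , (l , l≗v)) =
    orOp k l  , λ j → trans (cong₂ _∨_ (k≗u j) (l≗v j)) (sym (valid j))
  gateOp c (notG u z)   valid (k , k≗u) =
    notOp k   , λ j → trans (cong not (k≗u j)) (sym (valid j))

module Saturation {n m : ℕ} (P : Fin m → Gate n) (valid : ∀ i → IsValidGate (P i)) where

  record Progress : Set where
    field
      {size}         : ℕ
      circuit        : Circuit n size
      used           : Fin size → Fin m
      used-injective : Injective _≡_ _≡_ used
      used-computed  : ∀ t → Computed circuit (outCol (P (used t)))
  open Progress

  Ready : ∀ {s} → Circuit n s → Fin m → Set
  Ready c i = InputsIn (Computed c) (P i) × ¬ Computed c (outCol (P i))

  ready? : ∀ {s} (c : Circuit n s) → Decidable (Ready c)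
  ready? c i = inputsIn? (computed? c) (P i) ×-dec ¬? (computed? c (outCol (P i)))

  extend : (p : Progress) (i : Fin m) → Ready (circuit p) i → Progress
  extend p i (inputs , fresh) = record
    { circuit        = circuit p ▷ op
    ; used           = used′
    ; used-injective = used′-injective
    ; used-computed  = used′-computed
    }
    where
    new : Σ (Op (size p + n)) λ op → colOf (circuit p ▷ op) Fin.zero ≗ outCol (P i)
    new = gateOp (circuit p) (P i) (valid i) inputs

    op : Op (size p + n)
    op = proj₁ new

    used′ : Fin (suc (size p)) → Fin m
    used′ Fin.zero    = i
    used′ (Fin.suc t) = used p t

    used′-computed : ∀ t → Computed (circuit p ▷ op) (outCol (P (used′ t)))
    used′-computed Fin.zero    = Fin.zero , proj₂ new
    used′-computed (Fin.suc t) = let (k , k≗z) = used-computed p t in Fin.suc k , k≗z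

    i≢used : ∀ t → i ≢ used p t
    i≢used t refl = fresh (used-computed p t)

    used′-injective : Injective _≡_ _≡_ used′
    used′-injective {Fin.zero}  {Fin.zero}  _  = refl
    used′-injective {Fin.zero}  {Fin.suc b} eq = ⊥-elim (i≢used b eq)
    used′-injective {Fin.suc a} {Fin.zero}  eq = ⊥-elim (i≢used a (sym eq))
    used′-injective {Fin.suc a} {Fin.suc b} eq = cong Fin.suc (used-injective p eq)

  saturate : (fuel : ℕ) (p : Progress) → m < fuel + size p →
             Σ Progress λ p → ClosedUnder P (Computed (circuit p))
  saturate zero p m<size = ⊥-elim (<⇒≱ m<size (injective⇒≤ (used-injective p)))
  saturate (suc fuel) p bound with any? (ready? (circuit p))
  ... | yes (i , ready) =
    saturate fuel (extend p i ready) (subst (m <_) (sym (+-suc fuel (size p))) bound)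
  ... | no none = p , λ i inputs →
    decidable-stable (computed? (circuit p) (outCol (P i))) (λ fresh → none (i , inputs , fresh))

  closed-circuit : Σ ℕ λ s → s ≤ m × Σ (Circuit n s) λ c → ClosedUnder P (Computed c)
  closed-circuit =
    let (p , closed) = saturate (suc m) empty (m≤m+n (suc m) 0)
    in size p , injective⇒≤ (used-injective p) , circuit p , closed
    where
    empty : Progress
    empty = record { circuit = [] ; used = λ () ; used-injective = λ { {()} } ; used-computed = λ () }

mainTheorem4 : (n : ℕ) → 1 ≤ n → (f : BoolFn n) →
    (m : ℕ) → (P : Fin m → Gate n) → IsPPolCover n f m P →
    CCAtMost n f m
mainTheorem4 n _ f m P cover with Saturation.closed-circuit P (IsPPolCover.valid cover)
... | s , s≤m , c , closed = s , s≤m , c , o , computes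
  where
  rcol-computed : Computed c (rcol n f)
  rcol-computed = rcol-∈-closure cover (computed? c) (xcol-computed c) closed

  o : Fin (s + n)
  o = proj₁ rcol-computed

  computes : Computes c o f
  computes x with row-surjective n x
  ... | j , row≗x = begin
    lookup (values c x) o ≡⟨ cong (λ vs → lookup vs o) (values-cong c (sym ∘ row≗x)) ⟩
    colOf c o j           ≡⟨ proj₂ rcol-computed j ⟩
    rcol n f j            ≡⟨ rcol-correct cover (computed? c) (xcol-computed c) closed x j row≗x ⟩
    f x                   ∎
    where open ≡-Reasoning
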